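{- Let $G=(\mathfrak{N},\mathfrak{T},\mathfrak{R},\mathfrak{S})$ be a context-free grammar, $\Sigma$ a set of characters, $(\textsl{Lex},\textsl{Sel})$ a local lexing with respect to $\mathfrak{T}$ and $\Sigma$, and $D\in\Sigma^*$. Let $p$ be a sequence of tokens. Then $p\in\mathfrak{P}$ if and only if (a) $p_i\in\mathcal{Z}^{\infty}_{|\overline{p_0\ldots p_{i-1}}|}$ for all $0\le i<|p|$, and (b) $[p]\in\mathcal{L}_{\text{prefix}}$.
   Context: Notation: for a set $U$, $U^*$ is the set of finite sequences over $U$, $\varepsilon$ the empty sequence, juxtaposition is concatenation, $|\alpha|$ is the length and $\alpha_i$ ($0\le i<|\alpha|$) the $i$-th element. A context-free grammar $(\mathfrak{N},\mathfrak{T},\mathfrak{R},\mathfrak{S})$ has disjoint nonterminals $\mathfrak{N}$ and terminals $\mathfrak{T}$, rules $\mathfrak{R}\subseteq\mathfrak{N}\times(\mathfrak{N}\cup\mathfrak{T})^*$, start symbol $\mathfrak{S}$; $\overset{*}{\Rightarrow}$ is the reflexive transitive closure of one-step derivation. $\mathcal{L}_{\text{prefix}}=\{w\in\mathfrak{T}^*\mid \exists\alpha\in(\mathfrak{N}\cup\mathfrak{T})^*.\ \mathfrak{S}\overset{*}{\Rightarrow}w\alpha\}$. Tokens: a token is a pair $x=(t,c)\in\mathfrak{T}\times\Sigma^*$; write $[x]=t$, $\overline{x}=c$, and for a token sequence (path) $q=x_0\ldots x_r$, $[q]=[x_0]\ldots[x_r]$ and $\overline{q}=\overline{x_0}\ldots\overline{x_r}$.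 A local lexing is a pair $(\textsl{Lex},\textsl{Sel})$ where: $\textsl{Lex}$ assigns to each $t\in\mathfrak{T}$ a function $\textsl{Lex}(t)$ which, given $D\in\Sigma^*$ and $k\in\{0,\ldots,|D|\}$, returns a set of tokens of the form $(t,c)$ with $k+|c|\le|D|$ and $c_i=D_{k+i}$ for $0\le i\le |c|-1$; and $\textsl{Sel}$ takes token sets $A\subseteq B$ and returns a token set with $A\subseteq\textsl{Sel}(A,B)\subseteq B$. Local lexing semantics for input $D$: let $\operatorname{limit} f\, X=\bigcup_{n\ge0}f^n(X)$. Let $\mathcal{X}_k=\{x\in\mathfrak{T}\times\Sigma^*\mid x\in\textsl{Lex}([x])(D,k)\}$ and $\operatorname{Append}_k\,T\,P=P\cup\{pt\mid p\in P,\ |\overline{p}|=k,\ t\in T,\ [pt]\in\mathcal{L}_{\text{prefix}}\}$. Define recursively for $k\in\{0,\ldots,|D|\}$, $u\ge0$: $\mathcal{P}_0^0=\{\varepsilon\}$; $\mathcal{W}_k^u=\{x\in\mathcal{X}_k\mid\exists p\in\mathcal{P}_k^u.\ |\overline{p}|=k\wedge[px]\in\mathcal{L}_{\text{prefix}}\}$; $\mathcal{Z}_k^0=\emptyset$; $\mathcal{Z}_k^{u+1}=\textsl{Sel}(\mathcal{Z}_k^u,\mathcal{W}_k^u)$; $\mathcal{P}_k^{u+1}=\operatorname{limit}(\operatorname{Append}_k\,\mathcal{Z}_k^{u+1})\,\mathcal{P}_k^u$; $\mathcal{P}_k^\infty=\bigcup_{u}\mathcal{P}_k^u$; $\mathcal{P}_{k+1}^0=\mathcal{P}_k^\infty$.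 Put $\mathcal{Z}_k^\infty=\bigcup_{u\ge0}\mathcal{Z}_k^u$ and $\mathfrak{P}=\mathcal{P}_{|D|}^\infty$. -}

module Defs where

open import Data.Nat using (ℕ; zero; suc; _+_; _≤_)
open import Data.List using (List; []; _∷_; _++_; [_]; map; length; take; drop; concatMap; _∷ʳ_)
open import Data.Product using (Σ; ∃; _×_; _,_; proj₁; proj₂)
open import Data.Sum using (_⊎_; inj₁; inj₂)
open import Data.Empty using (⊥)
open import Relation.Binary.PropositionalEquality using (_≡_)
open import Relation.Binary.Construct.Closure.ReflexiveTransitive using (Star)

SetOf : Set → Set₁
SetOf A = A → Set

_⊆_ : {A : Set} → SetOf A → SetOf A → Set
X ⊆ Y = ∀ {a} → X a → Y a

record Grammar : Set₁ where
  field
    N     : Set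
    T     : Set
    R     : N → List (N ⊎ T) → Set
    start : N

  Sym : Set
  Sym = N ⊎ T

  _⇒_ : List Sym → List Sym → Set
  α ⇒ β = Σ (List Sym) λ l → Σ (List Sym) λ r → Σ N λ A → Σ (List Sym) λ γ →
            R A γ × (α ≡ l ++ [ inj₁ A ] ++ r) × (β ≡ l ++ γ ++ r)

  _⇒*_ : List Sym → List Sym → Set
  _⇒*_ = Star _⇒_

  Lprefix : SetOf (List T)
  Lprefix w = Σ (List Sym) λ α → [ inj₁ start ] ⇒* (map inj₂ w ++ α)

Token : Set → Set → Set
Token T Σc = T × List Σc

chars : {T Σc : Set} → List (Token T Σc) → List Σc
chars = concatMap proj₂

terms : {T Σc : Set} → List (Token T Σc) → List T
terms = map proj₁

record LocalLexing (T Σc : Set) : Set₁ where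
  field
    Lex    : T → List Σc → ℕ → SetOf (Token T Σc)
    Lex-ok : ∀ t D k x → Lex t D k x →
               (proj₁ x ≡ t) × (k + length (proj₂ x) ≤ length D)
               × (take (length (proj₂ x)) (drop k D) ≡ proj₂ x)
    Sel    : SetOf (Token T Σc) → SetOf (Token T Σc) → SetOf (Token T Σc)
    Sel-ok : ∀ (A B : SetOf (Token T Σc)) → A ⊆ B → (A ⊆ Sel A B) × (Sel A B ⊆ B)

iter : {A : Set} → (SetOf A → SetOf A) → ℕ → SetOf A → SetOf A
iter f zero    X = X
iter f (suc n) X = f (iter f n X)

limit : {A : Set} → (SetOf A → SetOf A) → SetOf A → SetOf A
limit f X a = Σ ℕ λ n → iter f n X a

module Semantics (G : Grammar) {Σc : Set} (LL : LocalLexing (Grammar.T G) Σc) (D : List Σc) where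
  open Grammar G
  open LocalLexing LL

  Tok : Set
  Tok = Token T Σc

  Path : Set
  Path = List Tok

  𝒳 : ℕ → SetOf Tok
  𝒳 k x = Lex (proj₁ x) D k x

  Append : ℕ → SetOf Tok → SetOf Path → SetOf Path
  Append k Tset P q = P q ⊎ (Σ Path λ p → Σ Tok λ t →
      (q ≡ p ∷ʳ t) × P p × (length (chars p) ≡ k) × Tset t × Lprefix (terms (p ∷ʳ t)))

  mutual
    𝒫 : ℕ → ℕ → SetOf Path
    𝒫 zero    zero    q = q ≡ []
    𝒫 (suc k) zero    q = Σ ℕ λ u → 𝒫 k u q
    𝒫 k       (suc u) = limit (Append k (𝒵 k (suc u))) (𝒫 k u)

    𝒵 : ℕ → ℕ → SetOf Tok
    𝒵 k zero    x = ⊥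
    𝒵 k (suc u) = Sel (𝒵 k u) (𝒲 k u)

    𝒲 : ℕ → ℕ → SetOf Tok
    𝒲 k u x = 𝒳 k x × (Σ Path λ p → 𝒫 k u p × (length (chars p) ≡ k) × Lprefix (terms (p ∷ʳ x)))

  𝒫∞ : ℕ → SetOf Path
  𝒫∞ k q = Σ ℕ λ u → 𝒫 k u q

  𝒵∞ : ℕ → SetOf Tok
  𝒵∞ k x = Σ ℕ λ u → 𝒵 k u x

  𝔓 : SetOf Path
  𝔓 = 𝒫∞ (length D)

-- Soundness: a path enters 𝒫ₖᵘ⁺¹ only by appending, at character offset k, a token of
-- 𝒵ₖᵘ⁺¹ such that the terminals stay in L_prefix; so every token of a path in 𝔓 is
-- selected at its own offset.  Completeness goes token by token: given q ∈ 𝔓 and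
-- x ∈ 𝒵ₖ^∞ with k = |q̄|, the path q already lies in 𝒫ₖ^∞, because a path of 𝒫_K^u
-- that is not in an earlier stage was appended at position K and so has at least K
-- characters.  As all stages are cumulative, q and x meet at a common stage of
-- position k, where qx is appended, and qx is then carried forward to position |D|.
module Submission where

open import Defs
open import Data.List using (List; length; take; lookup; []; _∷_; _++_; _∷ʳ_; [_]; map)
open import Data.List.Properties using (length-++; ++-assoc; ++-identityʳ; map-++; concatMap-++)
open import Data.Fin using (Fin; toℕ; zero; suc)
open import Data.Product using (_×_; _,_; proj₁; proj₂)
open import Data.Sum using (_⊎_; inj₁; inj₂)
open import Data.Unit using (⊤; tt)
open import Data.Nat using (ℕ; zero; suc; _+_; _≤_; _≤′_; ≤′-refl; ≤′-step; _⊔_; z≤n; s≤s⁻¹)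
open import Data.Nat.Properties
  using (+-assoc; +-identityʳ; m≤m+n; ≤-refl; ≤-trans; ≤-antisym; m≤n⇒m<n∨m≡n; ≤⇒≤′; m≤m⊔n; m≤n⊔m; n≤1+n)
open import Function using (_∘_)
open import Function.Bundles using (_⇔_; mk⇔)
open import Relation.Binary.PropositionalEquality using (_≡_; refl; sym; trans; cong; subst; subst₂)
open import Relation.Binary.Construct.Closure.ReflexiveTransitive using (ε)

iter-⊆ : {A : Set} {f : SetOf A → SetOf A} {X Q : SetOf A} →
         X ⊆ Q → (∀ {Y} → Y ⊆ Q → f Y ⊆ Q) → ∀ n → iter f n X ⊆ Q
iter-⊆ X⊆Q f-pres zero    x = X⊆Q x
iter-⊆ X⊆Q f-pres (suc n) x = f-pres (iter-⊆ X⊆Q f-pres n) x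

limit-⊆ : {A : Set} {f : SetOf A → SetOf A} {X Q : SetOf A} →
          X ⊆ Q → (∀ {Y} → Y ⊆ Q → f Y ⊆ Q) → limit f X ⊆ Q
limit-⊆ X⊆Q f-pres (n , x) = iter-⊆ X⊆Q f-pres n x

ascending-mono : {A : Set} (X : ℕ → SetOf A) → (∀ u → X u ⊆ X (suc u)) →
                 ∀ {u v} → u ≤ v → X u ⊆ X v
ascending-mono X step u≤v = go (≤⇒≤′ u≤v)
  where
  go : ∀ {u v} → u ≤′ v → X u ⊆ X v
  go ≤′-refl        x = x
  go (≤′-step u≤′v) x = step _ (go u≤′v x)

module _ {T Σc : Set} where

  length-chars-++ : (p q : List (Token T Σc)) →
                    length (chars (p ++ q)) ≡ length (chars p) + length (chars q)
  length-chars-++ p q = trans (cong length (concatMap-++ proj₂ p q)) (length-++ (chars p))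

  length-chars-∷ʳ : (p : List (Token T Σc)) (x : Token T Σc) →
                    length (chars (p ∷ʳ x)) ≡ length (chars p) + length (proj₂ x)
  length-chars-∷ʳ p x =
    trans (length-chars-++ p [ x ]) (cong ((length (chars p) +_) ∘ length) (++-identityʳ (proj₂ x)))

  offset-∷ : ∀ n (x : Token T Σc) q →
             n + length (chars (x ∷ q)) ≡ (n + length (proj₂ x)) + length (chars q)
  offset-∷ n x q = trans (cong (n +_) (length-++ (proj₂ x))) (sym (+-assoc n _ _))

module _ (G : Grammar) where
  open Grammar G

  Lprefix-++⁻ˡ : ∀ w v → Lprefix (w ++ v) → Lprefix w
  Lprefix-++⁻ˡ w v (α , d) =
    map inj₂ v ++ α ,
    subst ([ inj₁ start ] ⇒*_) (trans (cong (_++ α) (map-++ inj₂ w v)) (++-assoc (map inj₂ w) _ α)) d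

module Properties (G : Grammar) {Σc : Set} (LL : LocalLexing (Grammar.T G) Σc) (D : List Σc) where
  open Grammar G
  open LocalLexing LL
  open Semantics G LL D

  Lprefix-terms-++⁻ˡ : ∀ (p r : Path) → Lprefix (terms (p ++ r)) → Lprefix (terms p)
  Lprefix-terms-++⁻ˡ p r lp = Lprefix-++⁻ˡ G (terms p) (terms r) (subst Lprefix (map-++ proj₁ p r) lp)

  AllSelected : ℕ → Path → Set
  AllSelected n []       = ⊤
  AllSelected n (x ∷ xs) = 𝒵∞ n x × AllSelected (n + length (proj₂ x)) xs

  AllSelected-∷ʳ : ∀ n p x → AllSelected n p → 𝒵∞ (n + length (chars p)) x → AllSelected n (p ∷ʳ x)
  AllSelected-∷ʳ n []      x _          zx = subst (λ m → 𝒵∞ m x) (+-identityʳ n) zx , tt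
  AllSelected-∷ʳ n (y ∷ p) x (zy , sel) zx =
    zy , AllSelected-∷ʳ _ p x sel (subst (λ m → 𝒵∞ m x) (offset-∷ n y p) zx)

  AllSelected→lookup : ∀ n p → AllSelected n p →
    (i : Fin (length p)) → 𝒵∞ (n + length (chars (take (toℕ i) p))) (lookup p i)
  AllSelected→lookup n (x ∷ p) (zx , sel) zero    = subst (λ m → 𝒵∞ m x) (sym (+-identityʳ n)) zx
  AllSelected→lookup n (x ∷ p) (zx , sel) (suc i) =
    subst (λ m → 𝒵∞ m (lookup p i)) (sym (offset-∷ n x (take (toℕ i) p))) (AllSelected→lookup _ p sel i)

  lookup→AllSelected : ∀ n p →
    ((i : Fin (length p)) → 𝒵∞ (n + length (chars (take (toℕ i) p))) (lookup p i)) → AllSelected n p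
  lookup→AllSelected n []      f = tt
  lookup→AllSelected n (x ∷ p) f =
    subst (λ m → 𝒵∞ m x) (+-identityʳ n) (f zero) ,
    lookup→AllSelected _ p (λ i → subst (λ m → 𝒵∞ m (lookup p i)) (offset-∷ n x (take (toℕ i) p)) (f (suc i)))

  unfold-𝒫 : ∀ k u → 𝒫 k (suc u) ⊆ limit (Append k (𝒵 k (suc u))) (𝒫 k u)
  unfold-𝒫 zero    u h = h
  unfold-𝒫 (suc k) u h = h

  fold-𝒫 : ∀ k u → limit (Append k (𝒵 k (suc u))) (𝒫 k u) ⊆ 𝒫 k (suc u)
  fold-𝒫 zero    u h = h
  fold-𝒫 (suc k) u h = h

  𝒫-mono : ∀ k {u v} → u ≤ v → 𝒫 k u ⊆ 𝒫 k v
  𝒫-mono k = ascending-mono (𝒫 k) (λ u h → fold-𝒫 k u (0 , h))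

  𝒲-step : ∀ k u → 𝒲 k u ⊆ 𝒲 k (suc u)
  𝒲-step k u (x∈𝒳 , p , hp , cp , lp) = x∈𝒳 , p , 𝒫-mono k (n≤1+n u) hp , cp , lp

  𝒵⊆𝒲 : ∀ k u → 𝒵 k u ⊆ 𝒲 k u
  𝒵⊆𝒲 k zero    ()
  𝒵⊆𝒲 k (suc u) z = 𝒲-step k u (proj₂ (Sel-ok (𝒵 k u) (𝒲 k u) (𝒵⊆𝒲 k u)) z)

  𝒵-mono : ∀ k {u v} → u ≤ v → 𝒵 k u ⊆ 𝒵 k v
  𝒵-mono k = ascending-mono (𝒵 k) (λ u → proj₁ (Sel-ok (𝒵 k u) (𝒲 k u) (𝒵⊆𝒲 k u)))

  𝒫∞-mono : ∀ {k K} → k ≤ K → 𝒫∞ k ⊆ 𝒫∞ K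
  𝒫∞-mono = ascending-mono 𝒫∞ (λ k h → 0 , h)

  𝒵∞-offset≤ : ∀ {k x} → 𝒵∞ k x → k ≤ length D
  𝒵∞-offset≤ {k} {x} (u , zx) =
    ≤-trans (m≤m+n k _) (proj₁ (proj₂ (Lex-ok (proj₁ x) D k x (proj₁ (𝒵⊆𝒲 k u zx)))))

  𝒫-suc-fresh : ∀ K u {q} → 𝒫 K (suc u) q → 𝒫 K u q ⊎ K ≤ length (chars q)
  𝒫-suc-fresh K u h = limit-⊆ {Q = OldOrLong} inj₁ appended (unfold-𝒫 K u h)
    where
    OldOrLong : SetOf Path
    OldOrLong q = 𝒫 K u q ⊎ K ≤ length (chars q)

    appended : ∀ {Y} → Y ⊆ OldOrLong → Append K (𝒵 K (suc u)) Y ⊆ OldOrLong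
    appended Y⊆Q (inj₁ y)                              = Y⊆Q y
    appended Y⊆Q (inj₂ (p , t , refl , _ , cp , _ , _)) =
      inj₂ (subst₂ _≤_ cp (sym (length-chars-++ p [ t ])) (m≤m+n _ _))

  𝒫-lower : ∀ K u {q k} → 𝒫 K u q → length (chars q) ≤ k → k ≤ K → 𝒫∞ k q
  𝒫-lower zero    zero     h       _ z≤n = 0 , h
  𝒫-lower (suc K) zero     (u , h) c k≤1+K with m≤n⇒m<n∨m≡n k≤1+K
  ... | inj₁ k<1+K = 𝒫-lower K u h c (s≤s⁻¹ k<1+K)
  ... | inj₂ refl  = 0 , (u , h)
  𝒫-lower K       (suc u)  h       c k≤K with 𝒫-suc-fresh K u h
  ... | inj₁ h′ = 𝒫-lower K u h′ c k≤K
  ... | inj₂ K≤ rewrite ≤-antisym k≤K (≤-trans K≤ c) = suc u , h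

  Sound : SetOf Path
  Sound q = AllSelected 0 q × Lprefix (terms q)

  𝒫-sound : ∀ K u → 𝒫 K u ⊆ Sound
  𝒫-sound zero    zero    refl    = tt , [ inj₁ start ] , ε
  𝒫-sound (suc K) zero    (u , h) = 𝒫-sound K u h
  𝒫-sound K       (suc u) h       = limit-⊆ (𝒫-sound K u) appended (unfold-𝒫 K u h)
    where
    appended : ∀ {Y} → Y ⊆ Sound → Append K (𝒵 K (suc u)) Y ⊆ Sound
    appended Y⊆S (inj₁ y) = Y⊆S y
    appended Y⊆S (inj₂ (p , t , refl , hp , cp , zt , lp)) =
      AllSelected-∷ʳ 0 p t (proj₁ (Y⊆S hp)) (suc u , subst (λ m → 𝒵 m (suc u) t) (sym cp) zt) , lp

  𝔓-[] : 𝔓 []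
  𝔓-[] = 𝒫∞-mono {0} {length D} z≤n (0 , refl)

  𝔓-∷ʳ : ∀ {q x} → 𝔓 q → 𝒵∞ (length (chars q)) x → Lprefix (terms (q ∷ʳ x)) → 𝔓 (q ∷ʳ x)
  𝔓-∷ʳ {q} {x} (v , hq) (u , zx) lp =
    𝒫∞-mono k≤D (suc w , fold-𝒫 k w (1 , inj₂ (q , x , refl , hq′ , refl , zx′ , lp)))
    where
    k   = length (chars q)
    k≤D = 𝒵∞-offset≤ (u , zx)
    hq↓ = 𝒫-lower (length D) v hq ≤-refl k≤D
    w   = proj₁ hq↓ ⊔ u
    hq′ : 𝒫 k w q
    hq′ = 𝒫-mono k (m≤m⊔n _ u) (proj₂ hq↓)
    zx′ : 𝒵 k (suc w) x
    zx′ = 𝒵-mono k (≤-trans (m≤n⊔m (proj₁ hq↓) u) (n≤1+n w)) zx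

  𝔓-++ : ∀ q r → 𝔓 q → AllSelected (length (chars q)) r → Lprefix (terms (q ++ r)) → 𝔓 (q ++ r)
  𝔓-++ q []      hq _          _  = subst 𝔓 (sym (++-identityʳ q)) hq
  𝔓-++ q (x ∷ r) hq (zx , sel) lp = subst 𝔓 (++-assoc q [ x ] r) (𝔓-++ (q ∷ʳ x) r hqx sel′ lp′)
    where
    lp′ : Lprefix (terms ((q ∷ʳ x) ++ r))
    lp′ = subst (Lprefix ∘ terms) (sym (++-assoc q [ x ] r)) lp
    hqx : 𝔓 (q ∷ʳ x)
    hqx = 𝔓-∷ʳ hq zx (Lprefix-terms-++⁻ˡ (q ∷ʳ x) r lp′)
    sel′ : AllSelected (length (chars (q ∷ʳ x))) r
    sel′ = subst (λ n → AllSelected n r) (sym (length-chars-∷ʳ q x)) sel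

theorem4 : (G : Grammar) {Σc : Set} (LL : LocalLexing (Grammar.T G) Σc) (D : List Σc)
    (p : List (Token (Grammar.T G) Σc)) →
    Semantics.𝔓 G LL D p ⇔
      (((i : Fin (length p)) →
          Semantics.𝒵∞ G LL D (length (chars (take (toℕ i) p))) (lookup p i))
       × Grammar.Lprefix G (terms p))
theorem4 G LL D p = mk⇔
  (λ { (u , h) → let (sel , lp) = 𝒫-sound (length D) u h in AllSelected→lookup 0 p sel , lp })
  (λ { (f , lp) → 𝔓-++ [] p 𝔓-[] (lookup→AllSelected 0 p f) lp })
  where open Properties G LL D
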